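{- Let $n = 2k \geq 4$ be even. The schedule generated by the circle design for an asynchronous single round-robin tournament with $n$ teams has guaranteed rest time $k-2$ and games-played difference index $1$; its rest difference index is $2$ if $n \geq 6$ and $1$ if $n = 4$.
   Context: An asynchronous single round-robin tournament with $n$ teams is one in which every pair of distinct teams plays exactly once and no two games are simultaneous; a schedule is a linear ordering of the $\binom{n}{2}$ games. Circle design for $n=2k$: the teams are placed in two rows of $k$ positions, top row $t_1,\dots,t_k$ and bottom row $b_1,\dots,b_k$ (initial placement arbitrary). A round consists of the $k$ games $\{t_1,b_1\},\{t_2,b_2\},\dots,\{t_k,b_k\}$, played in this order (left to right). To obtain the next round, the team at $t_1$ stays fixed and the other teams rotate one step: the new $t_2$ is the old $b_1$, the new $t_j$ is the old $t_{j-1}$ for $3\le j\le k$, the new $b_k$ is the old $t_k$, and the new $b_j$ is the old $b_{j+1}$ for $1\le j\le k-1$. Performing $n-2$ rotations gives $n-1$ rounds, and the schedule is the concatenation of the rounds in order. The guaranteed rest time of a schedule is the maximum integer $b$ such that any two games involving the same team are separated by at least $b$ games not involving that team. The games-played difference index is the minimum integer $p$ such that at every point in the schedule (after any initial segment of games), the numbers of games played so far by any two teams differ by at most $p$. The rest difference index is the minimum integer $d$ such that for every game in the schedule, if one of its teams has not played in $i_1$ consecutive games since its last game and the other has not played in $i_2$ consecutive games since its last game, then $|i_1-i_2|\le d$; here, for a team playing its first game, all teams are deemed to have played in an imaginary game placed immediately before the first game of the schedule. -}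

module Defs where

open import Data.Nat using (ℕ; zero; suc; _+_; _∸_; _≤_; _<_; ∣_-_∣)
open import Data.Fin using (Fin; zero; suc; toℕ; fromℕ; inject₁; _↑ˡ_; _↑ʳ_; _≟_)
open import Data.Fin.Permutation using (Permutation′; _⟨$⟩ʳ_)
open import Data.List using (List; []; _∷_; length; lookup; take; drop; filter; map; concat; iterate; tabulate; reverse)
open import Data.Product using (_×_; _,_; proj₁; proj₂)
open import Data.Sum using (_⊎_)
open import Relation.Nullary using (¬_; Dec; yes; no)
open import Relation.Nullary.Decidable using (_⊎-dec_; ¬?)
open import Relation.Binary.PropositionalEquality using (_≡_)

Game : ℕ → Set
Game n = Fin n × Fin n

Schedule : ℕ → Set
Schedule n = List (Game n)

_∈g_ : ∀ {n} → Fin n → Game n → Set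
a ∈g g = a ≡ proj₁ g ⊎ a ≡ proj₂ g

_∈g?_ : ∀ {n} (a : Fin n) (g : Game n) → Dec (a ∈g g)
a ∈g? g = (a ≟ proj₁ g) ⊎-dec (a ≟ proj₂ g)

playedIn : ∀ {n} → Fin n → List (Game n) → ℕ
playedIn a gs = length (filter (a ∈g?_) gs)

notPlayedIn : ∀ {n} → Fin n → List (Game n) → ℕ
notPlayedIn a gs = length (filter (λ g → ¬? (a ∈g? g)) gs)

RestAtLeast : ∀ {n} → Schedule n → ℕ → Set
RestAtLeast {n} S b =
  ∀ (a : Fin n) (i j : Fin (length S)) → toℕ i < toℕ j →
  a ∈g lookup S i → a ∈g lookup S j →
  b ≤ notPlayedIn a (take (toℕ j ∸ suc (toℕ i)) (drop (suc (toℕ i)) S))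

GuaranteedRestTime : ∀ {n} → Schedule n → ℕ → Set
GuaranteedRestTime S b = RestAtLeast S b × (∀ c → RestAtLeast S c → c ≤ b)

PlayedDiffAtMost : ∀ {n} → Schedule n → ℕ → Set
PlayedDiffAtMost {n} S p =
  ∀ (m : ℕ) → m ≤ length S → ∀ (a b : Fin n) →
  ∣ playedIn a (take m S) - playedIn b (take m S) ∣ ≤ p

GamesPlayedDifferenceIndex : ∀ {n} → Schedule n → ℕ → Set
GamesPlayedDifferenceIndex S p =
  PlayedDiffAtMost S p × (∀ q → PlayedDiffAtMost S q → p ≤ q)

idleRev : ∀ {n} → Fin n → List (Game n) → ℕ
idleRev a [] = zero
idleRev a (g ∷ gs) with a ∈g? g
... | yes _ = zero
... | no  _ = suc (idleRev a gs)

-- games not involving a since a's last game before the given prefix ends;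
-- if a has not played yet, this counts all games of the prefix, which is
-- exactly the convention of an imaginary game before the first game
idle : ∀ {n} → Fin n → List (Game n) → ℕ
idle a prefix = idleRev a (reverse prefix)

RestDiffAtMost : ∀ {n} → Schedule n → ℕ → Set
RestDiffAtMost S d =
  ∀ (j : Fin (length S)) →
  ∣ idle (proj₁ (lookup S j)) (take (toℕ j) S)
  - idle (proj₂ (lookup S j)) (take (toℕ j) S) ∣ ≤ d

RestDifferenceIndex : ∀ {n} → Schedule n → ℕ → Set
RestDifferenceIndex S d =
  RestDiffAtMost S d × (∀ e → RestDiffAtMost S e → d ≤ e)

-- two rows of k positions (indexed 0 .. k-1, i.e. position j+1 of the paper)
record Rows (T : Set) (k : ℕ) : Set where
  constructor rows
  field
    top : Fin k → T
    bot : Fin k → T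
open Rows public

rotTop : ∀ {T : Set} {k} → (Fin (suc k) → T) → (Fin (suc k) → T) → Fin (suc k) → T
rotTop t b zero = t zero
rotTop t b (suc zero) = b zero
rotTop t b (suc (suc j)) = t (suc (inject₁ j))

rotBot : ∀ {T : Set} {k} → (Fin (suc k) → T) → T → Fin (suc k) → T
rotBot {k = zero} b x zero = x
rotBot {k = suc k} b x zero = b (suc zero)
rotBot {k = suc k} b x (suc i) = rotBot (λ j → b (suc j)) x i

rotate : ∀ {T : Set} {k} → Rows T (suc k) → Rows T (suc k)
rotate {k = k} (rows t b) = rows (rotTop t b) (rotBot b (t (fromℕ k)))

round : ∀ {T : Set} {k} → Rows T k → List (T × T)
round (rows t b) = tabulate (λ j → (t j , b j))

initialRows : ∀ k → Permutation′ (k + k) → Rows (Fin (k + k)) k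
initialRows k π = rows (λ j → π ⟨$⟩ʳ (j ↑ˡ k)) (λ j → π ⟨$⟩ʳ (k ↑ʳ j))

circleSchedule : ∀ k → Permutation′ (k + k) → Schedule (k + k)
circleSchedule zero π = []
circleSchedule (suc k) π =
  concat (map round (iterate rotate (initialRows (suc k) π) (suc k + suc k ∸ 1)))

module Submission where

open import Defs
open import Data.Nat using (ℕ; _+_; _∸_; _≤_)
open import Data.Fin.Permutation using (Permutation′)
open import Data.Product using (_×_)
open import Relation.Binary.PropositionalEquality using (_≡_)

open import Data.Nat using (zero; suc; _*_; _⊓_; _<_; _/_; _%_; _<?_; ∣_-_∣; s≤s; z≤n; s≤s⁻¹)
open import Data.Nat.Properties
open import Data.Nat.DivMod using (m≡m%n+[m/n]*n; m%n<n; m<n*o⇒m/o<n)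
open import Data.Nat.Solver using (module +-*-Solver)
open import Data.Fin using (Fin; zero; suc; toℕ; fromℕ; fromℕ<; inject₁; _↑ˡ_; _↑ʳ_)
open import Data.Fin.Properties
  using (toℕ-injective; toℕ<n; toℕ-↑ˡ; toℕ-↑ʳ; toℕ-inject₁; toℕ-fromℕ; toℕ-fromℕ<) renaming (0≢1+n to zero≢suc)
open import Data.Fin.Permutation using (_⟨$⟩ʳ_; _⟨$⟩ˡ_; inverseˡ; inverseʳ)
open import Data.List using ([]; _∷_; _++_; length; lookup; take; drop; filter; map; concat; iterate; tabulate; reverse)
open import Data.List.Properties using (filter-accept; filter-reject; filter-++; length-++; length-filter; length-take; reverse-++)
open import Data.Product using (_,_; proj₁; proj₂; ∃-syntax)
open import Data.Sum using (_⊎_; inj₁; inj₂)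
open import Data.Empty using (⊥; ⊥-elim)
open import Function using (_∘_)
open import Relation.Nullary using (¬_; Dec; yes; no)
open import Relation.Nullary.Decidable using (¬?)
open import Relation.Binary using (tri<; tri≈; tri>)
open import Relation.Binary.PropositionalEquality using (_≢_; refl; sym; trans; cong; cong₂; subst; subst₂; module ≡-Reasoning)

open +-*-Solver using (solve; _:+_; _:=_; con)

-- Write k = L + 2 = K + 1.  The schedule has m = n − 1 rounds of k games, and
-- its game number r·k + s is slot s of round r.  If every team plays exactly once per round, in slot σ(r) of
--     round r, then after any prefix each team has played r or r + 1 games.
--     If moreover σ(r) ≤ σ(r+1) + 1, any two games of a team are at least K
--     indices apart, so the rest time is at least L; and before its game in
--     slot s of round r + 1 a team has been idle for (K − σ(r)) + s games.
-- (2) Circle positions.  The 2K + 1 rotating teams move one step per round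
--     around a cycle of positions; the position determines the slot, which
--     never drops by more than one per rotation.
-- (3) The design.  circleSchedule is the list of games G 0, …, G (N − 1)
--     read off the rotated rows, so every team has such a rhythm.  The rest
--     difference of slot s in round r + 1 is the difference of the previous
--     slots of its two teams, which is 1 or 2; explicit games show that all
--     bounds are attained.

-- The games G x, G (x+1), …, G (x+l-1) of a game function G : ℕ → Game n.
-- The circle schedule will turn out to be an initial segment of this form.
module Segments {n : ℕ} (G : ℕ → Game n) where

  segment : ℕ → ℕ → Schedule n
  segment x zero    = []
  segment x (suc l) = G x ∷ segment (suc x) l

  length-segment : ∀ x l → length (segment x l) ≡ l
  length-segment x zero    = refl
  length-segment x (suc l) = cong suc (length-segment (suc x) l)

  lookup-segment : ∀ x l (i : Fin (length (segment x l))) →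
                   lookup (segment x l) i ≡ G (x + toℕ i)
  lookup-segment x (suc l) zero    = cong G (sym (+-identityʳ x))
  lookup-segment x (suc l) (suc i) =
    trans (lookup-segment (suc x) l i) (cong G (sym (+-suc x (toℕ i))))

  take-segment : ∀ x l t → t ≤ l → take t (segment x l) ≡ segment x t
  take-segment x l       zero    _         = refl
  take-segment x (suc l) (suc t) (s≤s t≤l) = cong (G x ∷_) (take-segment (suc x) l t t≤l)

  drop-segment : ∀ x l d → d ≤ l → drop d (segment x l) ≡ segment (x + d) (l ∸ d)
  drop-segment x l       zero    _         = cong (λ y → segment y l) (sym (+-identityʳ x))
  drop-segment x (suc l) (suc d) (s≤s d≤l) =
    trans (drop-segment (suc x) l d d≤l) (cong (λ y → segment y (l ∸ d)) (sym (+-suc x d)))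

  segment-++ : ∀ x l l′ → segment x (l + l′) ≡ segment x l ++ segment (x + l) l′
  segment-++ x zero    l′ = cong (λ y → segment y l′) (sym (+-identityʳ x))
  segment-++ x (suc l) l′ = cong (G x ∷_) (trans (segment-++ (suc x) l l′)
    (cong (λ y → segment (suc x) l ++ segment y l′) (sym (+-suc x l))))

  segment-snoc : ∀ x l → segment x (suc l) ≡ segment x l ++ G (x + l) ∷ []
  segment-snoc x l = trans (cong (segment x) (+-comm 1 l)) (segment-++ x l 1)

  tabulate-segment : ∀ {l} (f : Fin l → Game n) x → (∀ j → f j ≡ G (x + toℕ j)) →
                     tabulate f ≡ segment x l
  tabulate-segment {zero}  f x h = refl
  tabulate-segment {suc l} f x h = cong₂ _∷_ (trans (h zero) (cong G (+-identityʳ x)))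
    (tabulate-segment (f ∘ suc) (suc x) (λ j → trans (h (suc j)) (cong G (+-suc x (toℕ j)))))

module Counting {n : ℕ} (a : Fin n) where

  playedIn-here : ∀ {g} gs → a ∈g g → playedIn a (g ∷ gs) ≡ suc (playedIn a gs)
  playedIn-here gs p = cong length (filter-accept (a ∈g?_) p)

  playedIn-skip : ∀ {g} gs → ¬ a ∈g g → playedIn a (g ∷ gs) ≡ playedIn a gs
  playedIn-skip gs p = cong length (filter-reject (a ∈g?_) p)

  playedIn-++ : ∀ gs hs → playedIn a (gs ++ hs) ≡ playedIn a gs + playedIn a hs
  playedIn-++ gs hs =
    trans (cong length (filter-++ (a ∈g?_) gs hs)) (length-++ (filter (a ∈g?_) gs))

  notPlayedIn-skip : ∀ {g} gs → ¬ a ∈g g → notPlayedIn a (g ∷ gs) ≡ suc (notPlayedIn a gs)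
  notPlayedIn-skip gs p = cong length (filter-accept (λ g → ¬? (a ∈g? g)) p)

  notPlayedIn≤length : ∀ gs → notPlayedIn a gs ≤ length gs
  notPlayedIn≤length = length-filter (λ g → ¬? (a ∈g? g))

  idleRev-here : ∀ {g} gs → a ∈g g → idleRev a (g ∷ gs) ≡ 0
  idleRev-here {g} gs p with a ∈g? g
  ... | yes _  = refl
  ... | no ¬p = ⊥-elim (¬p p)

  idleRev-skip : ∀ {g} gs → ¬ a ∈g g → idleRev a (g ∷ gs) ≡ suc (idleRev a gs)
  idleRev-skip {g} gs ¬p with a ∈g? g
  ... | yes p = ⊥-elim (¬p p)
  ... | no _  = refl

restAtLeast-≤-gap : ∀ {n} {S : Schedule n} {c} (a : Fin n) (i j : Fin (length S)) →
  toℕ i < toℕ j → a ∈g lookup S i → a ∈g lookup S j → RestAtLeast S c → c ≤ toℕ j ∸ suc (toℕ i)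
restAtLeast-≤-gap {n} {S} {c} a i j i<j pi pj rest = begin
  c                         ≤⟨ rest a i j i<j pi pj ⟩
  notPlayedIn a (take x ys) ≤⟨ Counting.notPlayedIn≤length a (take x ys) ⟩
  length (take x ys)        ≡⟨ length-take x ys ⟩
  x ⊓ length ys             ≤⟨ m⊓n≤m x (length ys) ⟩
  x                         ∎
  where
  open ≤-Reasoning
  x : ℕ
  x = toℕ j ∸ suc (toℕ i)
  ys : Schedule n
  ys = drop (suc (toℕ i)) S

-- After the first game its teams are one game ahead of a team not in it.
playedDiff-≥1 : ∀ {n} {g} {gs : Schedule n} {q} {a b} →
                a ∈g g → ¬ b ∈g g → PlayedDiffAtMost (g ∷ gs) q → 1 ≤ q
playedDiff-≥1 {g = g} {q = q} {a} {b} pa ¬pb diff = subst (_≤ q) first (diff 1 (s≤s z≤n) a b)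
  where
  first : ∣ playedIn a (g ∷ []) - playedIn b (g ∷ []) ∣ ≡ 1
  first = cong₂ ∣_-_∣ (Counting.playedIn-here a [] pa) (Counting.playedIn-skip b [] ¬pb)

module SegmentCounting {n : ℕ} (G : ℕ → Game n) (a : Fin n) where
  open Segments G
  open Counting a

  Absent : ℕ → ℕ → Set
  Absent x l = ∀ y → x ≤ y → y < x + l → ¬ a ∈g G y

  absent-head : ∀ {x l} → Absent x (suc l) → ¬ a ∈g G x
  absent-head {x} h = h x ≤-refl (m<m+n x (s≤s z≤n))

  absent-tail : ∀ {x l} → Absent x (suc l) → Absent (suc x) l
  absent-tail {x} {l} h y x<y y<1+x+l = h y (<⇒≤ x<y) (≤-trans y<1+x+l (≤-reflexive (sym (+-suc x l))))

  absent-init : ∀ {x l} → Absent x (suc l) → Absent x l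
  absent-init {x} h y x≤y y<x+l = h y x≤y (<-≤-trans y<x+l (+-monoʳ-≤ x (n≤1+n _)))

  playedIn-absent : ∀ x l → Absent x l → playedIn a (segment x l) ≡ 0
  playedIn-absent x zero    h = refl
  playedIn-absent x (suc l) h =
    trans (playedIn-skip _ (absent-head h)) (playedIn-absent (suc x) l (absent-tail h))

  playedIn-once : ∀ x l y → x ≤ y → y < x + l → a ∈g G y →
                  (∀ z → x ≤ z → z < x + l → a ∈g G z → z ≡ y) →
                  playedIn a (segment x l) ≡ 1
  playedIn-once x zero y x≤y y<x+0 _ _ =
    ⊥-elim (<⇒≱ (subst (y <_) (+-identityʳ x) y<x+0) x≤y)
  playedIn-once x (suc l) y x≤y y<x+1+l p unique with x ≟ y
  ... | yes refl = trans (playedIn-here _ p) (cong suc (playedIn-absent (suc x) l elsewhere))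
    where
    elsewhere : Absent (suc x) l
    elsewhere z x<z z<1+x+l q =
      <-irrefl (sym (unique z (<⇒≤ x<z) (≤-trans z<1+x+l (≤-reflexive (sym (+-suc x l)))) q)) x<z
  ... | no x≢y = trans (playedIn-skip _ (λ q → x≢y (unique x ≤-refl (m<m+n x (s≤s z≤n)) q)))
    (playedIn-once (suc x) l y (≤∧≢⇒< x≤y x≢y) (≤-trans y<x+1+l (≤-reflexive (+-suc x l))) p
      (λ z x<z z<1+x+l → unique z (<⇒≤ x<z) (≤-trans z<1+x+l (≤-reflexive (sym (+-suc x l))))))

  notPlayedIn-≥ : ∀ x l d → d ≤ l → Absent x d → d ≤ notPlayedIn a (segment x l)
  notPlayedIn-≥ x l       zero    _         _ = z≤n
  notPlayedIn-≥ x (suc l) (suc d) (s≤s d≤l) h =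
    subst (suc d ≤_) (sym (notPlayedIn-skip _ (absent-head h)))
          (s≤s (notPlayedIn-≥ (suc x) l d d≤l (absent-tail h)))

  idle-snoc : ∀ l → idle a (segment 0 (suc l)) ≡ idleRev a (G l ∷ reverse (segment 0 l))
  idle-snoc l = cong (idleRev a)
    (trans (cong reverse (segment-snoc 0 l)) (reverse-++ (segment 0 l) (G l ∷ [])))

  idle-absent : ∀ d → Absent 0 d → idle a (segment 0 d) ≡ d
  idle-absent zero    h = refl
  idle-absent (suc d) h = trans (idle-snoc d)
    (trans (idleRev-skip _ (h d z≤n ≤-refl)) (cong suc (idle-absent d (absent-init h))))

  idle-since : ∀ y d → a ∈g G y → Absent (suc y) d → idle a (segment 0 (suc y + d)) ≡ d
  idle-since y zero p h = begin
    idle a (segment 0 (suc (y + 0)))        ≡⟨ cong (λ t → idle a (segment 0 (suc t))) (+-identityʳ y) ⟩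
    idle a (segment 0 (suc y))              ≡⟨ idle-snoc y ⟩
    idleRev a (G y ∷ reverse (segment 0 y)) ≡⟨ idleRev-here _ p ⟩
    0                                       ∎
    where open ≡-Reasoning
  idle-since y (suc d) p h = begin
    idle a (segment 0 (suc (y + suc d)))    ≡⟨ cong (λ t → idle a (segment 0 (suc t))) (+-suc y d) ⟩
    idle a (segment 0 (suc (suc y + d)))    ≡⟨ idle-snoc (suc y + d) ⟩
    idleRev a (G (suc y + d) ∷ _)           ≡⟨ idleRev-skip _ (h (suc y + d) (s≤s (m≤m+n y d)) (s≤s (≤-reflexive (sym (+-suc y d))))) ⟩
    suc (idle a (segment 0 (suc y + d)))    ≡⟨ cong suc (idle-since y d p (absent-init h)) ⟩
    suc d                                   ∎
    where open ≡-Reasoning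

module RoundIndex (K : ℕ) where

  k : ℕ
  k = suc K

  index-< : ∀ {r r′} s s′ → s < k → r < r′ → r * k + s < r′ * k + s′
  index-< {r} {suc r′} s s′ s<k (s≤s r≤r′) = begin-strict
    r * k + s       <⟨ +-monoʳ-< (r * k) s<k ⟩
    r * k + k       ≤⟨ +-monoˡ-≤ k (*-monoˡ-≤ k r≤r′) ⟩
    r′ * k + k      ≡⟨ +-comm (r′ * k) k ⟩
    k + r′ * k      ≤⟨ m≤m+n (k + r′ * k) s′ ⟩
    k + r′ * k + s′ ∎
    where open ≤-Reasoning

  index-injective : ∀ {r r′ s s′} → s < k → s′ < k → r * k + s ≡ r′ * k + s′ → r ≡ r′ × s ≡ s′
  index-injective {r} {r′} {s} {s′} s<k s′<k eq with <-cmp r r′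
  ... | tri< r<r′ _ _ = ⊥-elim (<-irrefl eq (index-< s s′ s<k r<r′))
  ... | tri> _ _ r′<r = ⊥-elim (<-irrefl (sym eq) (index-< s′ s s′<k r′<r))
  ... | tri≈ _ refl _ = refl , +-cancelˡ-≡ (r * k) s s′ eq

  roundOf : ℕ → ℕ
  roundOf i = i / k

  slotOf : ℕ → ℕ
  slotOf i = i % k

  slotOf<k : ∀ i → slotOf i < k
  slotOf<k i = m%n<n i k

  roundOf-< : ∀ {i m} → i < m * k → roundOf i < m
  roundOf-< = m<n*o⇒m/o<n

  index-decompose : ∀ i → i ≡ roundOf i * k + slotOf i
  index-decompose i = trans (m≡m%n+[m/n]*n i k) (+-comm (slotOf i) (roundOf i * k))

  decompose-index : ∀ r s → s < k → roundOf (r * k + s) ≡ r × slotOf (r * k + s) ≡ s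
  decompose-index r s s<k =
    index-injective (slotOf<k (r * k + s)) s<k (sym (index-decompose (r * k + s)))

module Rhythms (L m : ℕ) {n : ℕ} (G : ℕ → Game n) where

  K : ℕ
  K = suc L

  open RoundIndex K
  open Segments G

  N : ℕ
  N = m * k

  record Rhythm (a : Fin n) (σ : ℕ → ℕ) : Set where
    field
      slot≤K    : ∀ r → σ r ≤ K
      plays     : ∀ r → r < m → a ∈g G (r * k + σ r)
      onlyThere : ∀ r s → r < m → s < k → a ∈g G (r * k + s) → s ≡ σ r

  SlowDescent : (ℕ → ℕ) → Set
  SlowDescent σ = ∀ r → σ r ≤ suc (σ (suc r))

  gameIndex : (ℕ → ℕ) → ℕ → ℕ
  gameIndex σ r = r * k + σ r

  module _ {a : Fin n} {σ : ℕ → ℕ} (ρ : Rhythm a σ) where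
    open Rhythm ρ
    open Counting a
    open SegmentCounting G a

    game-is-gameIndex : ∀ {z} → z < N → a ∈g G z → z ≡ gameIndex σ (roundOf z)
    game-is-gameIndex {z} z<N p = trans (index-decompose z) (cong (roundOf z * k +_)
      (onlyThere (roundOf z) (slotOf z) (roundOf-< z<N) (slotOf<k z)
        (subst (λ w → a ∈g G w) (index-decompose z) p)))

    gameIndex-< : ∀ {r r′} → r < r′ → gameIndex σ r < gameIndex σ r′
    gameIndex-< {r} {r′} = index-< (σ r) (σ r′) (s≤s (slot≤K r))

    gameIndex-≤ : ∀ {r r′} → r ≤ r′ → gameIndex σ r ≤ gameIndex σ r′
    gameIndex-≤ r≤r′ with m≤n⇒m<n∨m≡n r≤r′
    ... | inj₁ r<r′ = <⇒≤ (gameIndex-< r<r′)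
    ... | inj₂ refl = ≤-refl

    within-round : ∀ {r z} → r < m → r * k ≤ z → z < r * k + k → a ∈g G z → z ≡ gameIndex σ r
    within-round {r} {z} r<m r*k≤z z<r*k+k p = trans z≡ (cong (r * k +_) (onlyThere r s r<m s<k (subst (λ w → a ∈g G w) z≡ p)))
      where
      s : ℕ
      s = z ∸ r * k
      z≡ : z ≡ r * k + s
      z≡ = sym (m+[n∸m]≡n r*k≤z)
      s<k : s < k
      s<k = +-cancelˡ-< (r * k) s k (subst (_< r * k + k) z≡ z<r*k+k)

    playedIn-split : ∀ r s → playedIn a (segment 0 (r * k + s))
                             ≡ playedIn a (segment 0 (r * k)) + playedIn a (segment (r * k) s)
    playedIn-split r s = trans (cong (playedIn a) (segment-++ 0 (r * k) s)) (playedIn-++ (segment 0 (r * k)) (segment (r * k) s))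

    playedIn-round-before : ∀ {r s} → r < m → s ≤ σ r → playedIn a (segment (r * k) s) ≡ 0
    playedIn-round-before {r} {s} r<m s≤σ = playedIn-absent (r * k) s absent
      where
      absent : Absent (r * k) s
      absent y r*k≤y y<r*k+s py = <⇒≱ y<r*k+s (begin
        r * k + s   ≤⟨ +-monoʳ-≤ (r * k) s≤σ ⟩
        r * k + σ r ≡⟨ sym (within-round r<m r*k≤y (<-≤-trans y<r*k+s (+-monoʳ-≤ (r * k) (≤-trans s≤σ (m≤n⇒m≤1+n (slot≤K r))))) py) ⟩
        y           ∎)
        where open ≤-Reasoning

    playedIn-round-after : ∀ {r s} → r < m → σ r < s → s ≤ k → playedIn a (segment (r * k) s) ≡ 1
    playedIn-round-after {r} {s} r<m σ<s s≤k =
      playedIn-once (r * k) s (gameIndex σ r) (m≤m+n (r * k) (σ r)) (+-monoʳ-< (r * k) σ<s) (plays r r<m)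
        (λ z r*k≤z z<r*k+s → within-round r<m r*k≤z (<-≤-trans z<r*k+s (+-monoʳ-≤ (r * k) s≤k)))

    playedIn-rounds : ∀ r → r ≤ m → playedIn a (segment 0 (r * k)) ≡ r
    playedIn-rounds zero    _   = refl
    playedIn-rounds (suc r) r<m = begin
      playedIn a (segment 0 (k + r * k))   ≡⟨ cong (playedIn a ∘ segment 0) (+-comm k (r * k)) ⟩
      playedIn a (segment 0 (r * k + k))   ≡⟨ playedIn-split r k ⟩
      playedIn a (segment 0 (r * k)) + playedIn a (segment (r * k) k)
        ≡⟨ cong₂ _+_ (playedIn-rounds r (<⇒≤ r<m)) (playedIn-round-after r<m (s≤s (slot≤K r)) ≤-refl) ⟩
      r + 1                                ≡⟨ +-comm r 1 ⟩
      suc r                                ∎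
      where open ≡-Reasoning

    playedIn-during : ∀ r s → r < m → s < k →
      playedIn a (segment 0 (r * k + s)) ≡ r ⊎ playedIn a (segment 0 (r * k + s)) ≡ suc r
    playedIn-during r s r<m s<k with σ r <? s
    ... | yes σ<s = inj₂ (trans (playedIn-split r s)
            (trans (cong₂ _+_ (playedIn-rounds r (<⇒≤ r<m)) (playedIn-round-after r<m σ<s (<⇒≤ s<k))) (+-comm r 1)))
    ... | no  σ≮s = inj₁ (trans (playedIn-split r s)
            (trans (cong₂ _+_ (playedIn-rounds r (<⇒≤ r<m)) (playedIn-round-before r<m (≮⇒≥ σ≮s))) (+-identityʳ r)))

    idle-round0 : 0 < m → ∀ s → s < k → a ∈g G s → idle a (segment 0 s) ≡ s
    idle-round0 0<m s s<k p = idle-absent s absent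
      where
      absent : Absent 0 s
      absent y _ y<s py =
        <-irrefl (trans (onlyThere 0 y 0<m (<-trans y<s s<k) py) (sym (onlyThere 0 s 0<m s<k p))) y<s

    -- before its game in slot s of round r+1 a team has been idle since its
    -- game in round r, i.e. for the rest of round r and the first s games
    idle-next-round : ∀ r s → suc r < m → s < k → a ∈g G (suc r * k + s) →
                      idle a (segment 0 (suc r * k + s)) ≡ (K ∸ σ r) + s
    idle-next-round r s r+1<m s<k p =
      subst (λ t → idle a (segment 0 t) ≡ d) elapsed (idle-since y d (plays r (<-trans (n<1+n r) r+1<m)) absent)
      where
      y : ℕ
      y = gameIndex σ r
      d : ℕ
      d = (K ∸ σ r) + s
      x : ℕ
      x = suc r * k + s
      elapsed : suc y + d ≡ x
      elapsed = begin
        suc (r * k + σ r) + ((K ∸ σ r) + s)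
          ≡⟨ solve 4 (λ x σ d s → con 1 :+ (x :+ σ) :+ (d :+ s) := con 1 :+ (σ :+ d) :+ x :+ s)
                   refl (r * k) (σ r) (K ∸ σ r) s ⟩
        suc (σ r + (K ∸ σ r)) + r * k + s ≡⟨ cong (λ K′ → suc K′ + r * k + s) (m+[n∸m]≡n (slot≤K r)) ⟩
        x                                 ∎
        where open ≡-Reasoning
      x-is-gameIndex : x ≡ gameIndex σ (suc r)
      x-is-gameIndex = cong (suc r * k +_) (onlyThere (suc r) s r+1<m s<k p)
      x<N : x < N
      x<N = subst (x <_) (+-identityʳ N) (index-< s 0 s<k r+1<m)
      absent : Absent (suc y) d
      absent z y<z z<1+y+d pz = cases (roundOf z ≤? r)
        where
        z<x : z < x
        z<x = subst (z <_) elapsed z<1+y+d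
        z≡ : z ≡ gameIndex σ (roundOf z)
        z≡ = game-is-gameIndex (<-trans z<x x<N) pz
        cases : Dec (roundOf z ≤ r) → ⊥
        cases (yes rz≤r) = <⇒≱ y<z (subst (_≤ y) (sym z≡) (gameIndex-≤ rz≤r))
        cases (no rz≰r)  = <⇒≱ z<x (subst₂ _≤_ (sym x-is-gameIndex) (sym z≡) (gameIndex-≤ (≰⇒> rz≰r)))

    module _ (descent : SlowDescent σ) where

      gameIndex-apart : ∀ {r r′} → r < r′ → gameIndex σ r + K ≤ gameIndex σ r′
      gameIndex-apart {r} {suc r′} (s≤s r≤r′) with m≤n⇒m<n∨m≡n r≤r′
      ... | inj₂ refl = begin
        r * k + σ r + K                 ≤⟨ +-monoˡ-≤ K (+-monoʳ-≤ (r * k) (descent r)) ⟩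
        r * k + suc (σ (suc r)) + K     ≡⟨ solve 3 (λ x s K → x :+ (con 1 :+ s) :+ K := (con 1 :+ K) :+ x :+ s)
                                                 refl (r * k) (σ (suc r)) K ⟩
        k + r * k + σ (suc r)           ∎
        where open ≤-Reasoning
      ... | inj₁ r<r′ = begin
        r * k + σ r + K                 ≤⟨ +-monoˡ-≤ K (+-monoʳ-≤ (r * k) (slot≤K r)) ⟩
        r * k + K + K                   ≤⟨ +-mono-≤ (+-monoʳ-≤ (r * k) (n≤1+n K)) (n≤1+n K) ⟩
        r * k + k + k                   ≡⟨ solve 2 (λ x k → x :+ k :+ k := k :+ (k :+ x)) refl (r * k) k ⟩
        suc (suc r) * k                 ≤⟨ *-monoˡ-≤ k (s≤s r<r′) ⟩
        suc r′ * k                      ≤⟨ m≤m+n (suc r′ * k) (σ (suc r′)) ⟩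
        suc r′ * k + σ (suc r′)         ∎
        where open ≤-Reasoning

      games-apart : ∀ {i j} → i < j → j < N → a ∈g G i → a ∈g G j → i + K ≤ j
      games-apart {i} {j} i<j j<N pi pj =
        subst₂ (λ x y → x + K ≤ y) (sym i≡) (sym j≡) (gameIndex-apart rounds<)
        where
        i≡ : i ≡ gameIndex σ (roundOf i)
        i≡ = game-is-gameIndex (<-trans i<j j<N) pi
        j≡ : j ≡ gameIndex σ (roundOf j)
        j≡ = game-is-gameIndex j<N pj
        rounds< : roundOf i < roundOf j
        rounds< with <-cmp (roundOf i) (roundOf j)
        ... | tri< lt _ _ = lt
        ... | tri≈ _ eq _ = ⊥-elim (<-irrefl (trans i≡ (trans (cong (gameIndex σ) eq) (sym j≡))) i<j)
        ... | tri> _ _ gt = ⊥-elim (<-asym i<j (subst₂ _<_ (sym j≡) (sym i≡) (gameIndex-< gt)))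

  ∣-∣≤1 : ∀ {x y r} → (x ≡ r ⊎ x ≡ suc r) → (y ≡ r ⊎ y ≡ suc r) → ∣ x - y ∣ ≤ 1
  ∣-∣≤1 {r = r} (inj₁ refl) (inj₁ refl) = ≤-trans (≤-reflexive (∣n-n∣≡0 r)) z≤n
  ∣-∣≤1 {r = r} (inj₁ refl) (inj₂ refl) = ≤-reflexive (trans (cong (∣ r -_∣) (+-comm 1 r)) (∣m-m+n∣≡n r 1))
  ∣-∣≤1 {r = r} (inj₂ refl) (inj₁ refl) =
    ≤-reflexive (trans (∣-∣-comm (suc r) r) (trans (cong (∣ r -_∣) (+-comm 1 r)) (∣m-m+n∣≡n r 1)))
  ∣-∣≤1 {r = r} (inj₂ refl) (inj₂ refl) = ≤-trans (≤-reflexive (∣n-n∣≡0 (suc r))) z≤n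

  playedDiff≤1 : (∀ a → ∃[ σ ] Rhythm a σ) → PlayedDiffAtMost (segment 0 N) 1
  playedDiff≤1 rhythm t t≤len a b =
    subst (λ gs → ∣ playedIn a gs - playedIn b gs ∣ ≤ 1) (sym (take-segment 0 N t t≤N)) bound
    where
    t≤N : t ≤ N
    t≤N = subst (t ≤_) (length-segment 0 N) t≤len
    ρ : ∀ c → Rhythm c (proj₁ (rhythm c))
    ρ c = proj₂ (rhythm c)
    bound : ∣ playedIn a (segment 0 t) - playedIn b (segment 0 t) ∣ ≤ 1
    bound with m≤n⇒m<n∨m≡n t≤N
    ... | inj₂ refl = ≤-trans (≤-reflexive (trans
            (cong₂ ∣_-_∣ (playedIn-rounds (ρ a) m ≤-refl) (playedIn-rounds (ρ b) m ≤-refl)) (∣n-n∣≡0 m))) z≤n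
    ... | inj₁ t<N = subst (λ i → ∣ playedIn a (segment 0 i) - playedIn b (segment 0 i) ∣ ≤ 1)
            (sym (index-decompose t))
            (∣-∣≤1 (playedIn-during (ρ a) (roundOf t) (slotOf t) (roundOf-< t<N) (slotOf<k t))
                   (playedIn-during (ρ b) (roundOf t) (slotOf t) (roundOf-< t<N) (slotOf<k t)))

  restAtLeast : (∀ a → ∃[ σ ] (Rhythm a σ × SlowDescent σ)) → RestAtLeast (segment 0 N) L
  restAtLeast rhythm a i j i<j pi pj =
    subst (λ gs → L ≤ notPlayedIn a gs) (sym between) (notPlayedIn-≥ (suc ti) (tj ∸ suc ti) L L≤gap quiet)
    where
    open SegmentCounting G a
    ρ : Rhythm a (proj₁ (rhythm a))
    ρ = proj₁ (proj₂ (rhythm a))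
    descent : SlowDescent (proj₁ (rhythm a))
    descent = proj₂ (proj₂ (rhythm a))
    ti : ℕ
    ti = toℕ i
    tj : ℕ
    tj = toℕ j
    tj<N : tj < N
    tj<N = subst (tj <_) (length-segment 0 N) (toℕ<n j)
    at : ∀ (l : Fin (length (segment 0 N))) → a ∈g lookup (segment 0 N) l → a ∈g G (toℕ l)
    at l = subst (a ∈g_) (lookup-segment 0 N l)
    apart : ti + K ≤ tj
    apart = games-apart ρ descent i<j tj<N (at i pi) (at j pj)
    L≤gap : L ≤ tj ∸ suc ti
    L≤gap = m+n≤o⇒m≤o∸n L (subst (_≤ tj) (sym (trans (+-suc L ti) (+-comm K ti))) apart)
    between : take (tj ∸ suc ti) (drop (suc ti) (segment 0 N)) ≡ segment (suc ti) (tj ∸ suc ti)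
    between = trans (cong (take (tj ∸ suc ti)) (drop-segment 0 N (suc ti) (≤-trans i<j (<⇒≤ tj<N))))
                    (take-segment (suc ti) (N ∸ suc ti) (tj ∸ suc ti) (∸-monoˡ-≤ (suc ti) (<⇒≤ tj<N)))
    quiet : Absent (suc ti) L
    quiet y ti<y y<1+ti+L py = <⇒≱ y<ti+K (games-apart ρ descent ti<y y<N (at i pi) py)
      where
      y<ti+K : y < ti + K
      y<ti+K = ≤-trans y<1+ti+L (≤-reflexive (sym (+-suc ti L)))
      y<N : y < N
      y<N = <-≤-trans y<ti+K (≤-trans apart (<⇒≤ tj<N))

-- The 2K + 1 rotating teams of the circle design sit on a cycle of positions
-- 0, 1, …, M = 2K: position p < K is the top cell p + 1 and position p ≥ K is
-- the bottom cell M − p.  A rotation moves the team at position p to position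
-- p + 1 (and the one at M to 0).  The game played at position p is the one in
-- slot `slot p` of the round (the number of its cell).
module CirclePositions (L : ℕ) where

  K : ℕ
  K = suc L

  k : ℕ
  k = suc K

  M : ℕ
  M = K + K

  next : ℕ → ℕ
  next p with p ≟ M
  ... | yes _ = 0
  ... | no  _ = suc p

  prev : ℕ → ℕ
  prev zero    = M
  prev (suc p) = p

  next-M : next M ≡ 0
  next-M with M ≟ M
  ... | yes _   = refl
  ... | no  M≢M = ⊥-elim (M≢M refl)

  next-< : ∀ {p} → p < M → next p ≡ suc p
  next-< {p} p<M with p ≟ M
  ... | yes refl = ⊥-elim (<-irrefl refl p<M)
  ... | no  _    = refl

  next-≤ : ∀ {p} → p ≤ M → next p ≤ M
  next-≤ {p} p≤M with m≤n⇒m<n∨m≡n p≤M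
  ... | inj₁ p<M = subst (_≤ M) (sym (next-< p<M)) p<M
  ... | inj₂ refl = subst (_≤ M) (sym next-M) z≤n

  prev-≤ : ∀ {p} → p ≤ M → prev p ≤ M
  prev-≤ {zero}  _   = ≤-refl
  prev-≤ {suc p} p<M = <⇒≤ p<M

  prev-next : ∀ {p} → p ≤ M → prev (next p) ≡ p
  prev-next {p} p≤M with m≤n⇒m<n∨m≡n p≤M
  ... | inj₁ p<M = cong prev (next-< p<M)
  ... | inj₂ refl = cong prev next-M

  next-prev : ∀ {p} → p ≤ M → next (prev p) ≡ p
  next-prev {zero}  _   = next-M
  next-prev {suc p} p<M = next-< p<M

  advance : ℕ → ℕ → ℕ
  advance c zero    = c
  advance c (suc r) = next (advance c r)

  retreat : ℕ → ℕ → ℕ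
  retreat p zero    = p
  retreat p (suc r) = retreat (prev p) r

  advance-≤ : ∀ {c} r → c ≤ M → advance c r ≤ M
  advance-≤ zero    c≤M = c≤M
  advance-≤ (suc r) c≤M = next-≤ (advance-≤ r c≤M)

  retreat-≤ : ∀ {p} r → p ≤ M → retreat p r ≤ M
  retreat-≤ zero    p≤M = p≤M
  retreat-≤ (suc r) p≤M = retreat-≤ r (prev-≤ p≤M)

  retreat-advance : ∀ c r → c ≤ M → retreat (advance c r) r ≡ c
  retreat-advance c zero    _   = refl
  retreat-advance c (suc r) c≤M =
    trans (cong (λ p → retreat p r) (prev-next (advance-≤ r c≤M))) (retreat-advance c r c≤M)

  advance-retreat : ∀ p r → p ≤ M → advance (retreat p r) r ≡ p
  advance-retreat p zero    _   = refl
  advance-retreat p (suc r) p≤M =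
    trans (cong next (advance-retreat (prev p) r (prev-≤ p≤M))) (next-prev p≤M)

  slot : ℕ → ℕ
  slot p with p <? K
  ... | yes _ = suc p
  ... | no  _ = M ∸ p

  slot-< : ∀ {p} → p < K → slot p ≡ suc p
  slot-< {p} p<K with p <? K
  ... | yes _   = refl
  ... | no  p≮K = ⊥-elim (p≮K p<K)

  slot-≥ : ∀ {p} → K ≤ p → slot p ≡ M ∸ p
  slot-≥ {p} K≤p with p <? K
  ... | yes p<K = ⊥-elim (<⇒≱ p<K K≤p)
  ... | no  _   = refl

  M∸K : M ∸ K ≡ K
  M∸K = m+n∸n≡m K K

  M∸-≤ : ∀ {p} → K ≤ p → M ∸ p ≤ K
  M∸-≤ {p} K≤p = subst (M ∸ p ≤_) M∸K (∸-monoʳ-≤ M K≤p)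

  K≤M∸ : ∀ {j} → j ≤ K → K ≤ M ∸ j
  K≤M∸ {j} j≤K = subst (_≤ M ∸ j) M∸K (∸-monoʳ-≤ M j≤K)

  slot≤K : ∀ p → slot p ≤ K
  slot≤K p with p <? K
  ... | yes p<K = p<K
  ... | no  p≮K = M∸-≤ (≮⇒≥ p≮K)

  slot-M : slot M ≡ 0
  slot-M = trans (slot-≥ (m≤m+n K K)) (n∸n≡0 M)

  slot-bottom : ∀ {j} → j < K → slot (M ∸ suc j) ≡ suc j
  slot-bottom j<K = trans (slot-≥ (K≤M∸ j<K)) (m∸[m∸n]≡n (≤-trans j<K (m≤m+n K K)))

  slot-descent : ∀ {p} → p ≤ M → slot p ≤ suc (slot (next p))
  slot-descent {p} p≤M with m≤n⇒m<n∨m≡n p≤M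
  ... | inj₂ refl = subst (_≤ suc (slot (next M))) (sym slot-M) z≤n
  ... | inj₁ p<M  = subst (λ q → slot p ≤ suc (slot q)) (sym (next-< p<M)) (step (p <? K) (suc p <? K))
    where
    step : Dec (p < K) → Dec (suc p < K) → slot p ≤ suc (slot (suc p))
    step (yes p<K) (yes 1+p<K) = subst₂ _≤_ (sym (slot-< p<K)) (cong suc (sym (slot-< 1+p<K))) (m≤n⇒m≤1+n (n≤1+n (suc p)))
    step (yes p<K) (no 1+p≮K)  = subst₂ _≤_ (sym (slot-< p<K)) (cong suc (sym (slot-≥ (≮⇒≥ 1+p≮K))))
                                   (s≤s (<⇒≤ (<-≤-trans p<K (K≤M∸ p<K))))
    step (no p≮K)  _           = subst₂ _≤_ (sym (slot-≥ (≮⇒≥ p≮K)))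
                                   (cong suc (sym (slot-≥ (m≤n⇒m≤1+n (≮⇒≥ p≮K)))))
                                   (≤-reflexive (+-∸-assoc 1 p<M))

  -- the slots in round r of the teams that play, in round r + 1, slot s in
  -- the top row and in the bottom row respectively
  earlierSlotTop : ℕ → ℕ
  earlierSlotTop zero    = 0
  earlierSlotTop (suc j) = slot (prev j)

  earlierSlotBottom : ℕ → ℕ
  earlierSlotBottom s = slot (prev (M ∸ s))

  earlierSlotTop-suc : ∀ {j} → j < K → earlierSlotTop (suc j) ≡ j
  earlierSlotTop-suc {zero}  _     = slot-M
  earlierSlotTop-suc {suc j} 1+j<K = slot-< (<-trans (n<1+n j) 1+j<K)

  earlierSlotBottom-0 : earlierSlotBottom 0 ≡ 1
  earlierSlotBottom-0 =
    trans (slot-≥ (≤-trans (s≤s (m≤m+n L L)) (≤-reflexive (sym (+-suc L L))))) (m+n∸n≡m 1 (L + K))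

  earlierSlotBottom-< : ∀ {j} → j < L → earlierSlotBottom (suc j) ≡ suc (suc j)
  earlierSlotBottom-< {j} j<L =
    trans (cong (slot ∘ prev) (+-∸-assoc 1 (≤-trans (s≤s j<L) (m≤m+n K K)))) (slot-bottom (s≤s j<L))

  earlierSlotBottom-L : earlierSlotBottom K ≡ K
  earlierSlotBottom-L = trans (cong (slot ∘ prev) M∸K) (slot-< (n<1+n L))

-- x as an element of Fin (suc N), faithful for x ≤ N
toFin : ∀ N → ℕ → Fin (suc N)
toFin zero    _       = zero
toFin (suc N) zero    = zero
toFin (suc N) (suc x) = suc (toFin N x)

toℕ-toFin : ∀ N x → x ≤ N → toℕ (toFin N x) ≡ x
toℕ-toFin zero    zero    _         = refl
toℕ-toFin (suc N) zero    _         = refl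
toℕ-toFin (suc N) (suc x) (s≤s x≤N) = cong suc (toℕ-toFin N x x≤N)

rotBot-spec : ∀ {T : Set} {K′} (b : Fin (suc K′) → T) (x : T) (C : ℕ → T) →
  (∀ (i : Fin K′) → b (suc i) ≡ C (toℕ i)) → x ≡ C K′ → ∀ j → rotBot b x j ≡ C (toℕ j)
rotBot-spec {K′ = zero}   b x C hb hx zero    = hx
rotBot-spec {K′ = suc K′} b x C hb hx zero    = hb zero
rotBot-spec {K′ = suc K′} b x C hb hx (suc j) =
  rotBot-spec (b ∘ suc) x (C ∘ suc) (λ i → hb (suc i)) hx j

∣K∸+-K∸+∣ : ∀ {K x y} s → x ≤ K → y ≤ K → ∣ (K ∸ x) + s - (K ∸ y) + s ∣ ≡ ∣ x - y ∣
∣K∸+-K∸+∣ {K} {x} {y} s x≤K y≤K = begin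
  ∣ (K ∸ x) + s - (K ∸ y) + s ∣             ≡⟨ cong₂ ∣_-_∣ (+-comm (K ∸ x) s) (+-comm (K ∸ y) s) ⟩
  ∣ s + (K ∸ x) - s + (K ∸ y) ∣             ≡⟨ ∣m+n-m+o∣≡∣n-o∣ s (K ∸ x) (K ∸ y) ⟩
  ∣ (K ∸ x) - (K ∸ y) ∣                     ≡⟨ sym (∣m+n-m+o∣≡∣n-o∣ (x + y) (K ∸ x) (K ∸ y)) ⟩
  ∣ (x + y) + (K ∸ x) - (x + y) + (K ∸ y) ∣ ≡⟨ cong₂ ∣_-_∣ x+y+[K∸x] x+y+[K∸y] ⟩
  ∣ K + y - K + x ∣                         ≡⟨ ∣m+n-m+o∣≡∣n-o∣ K y x ⟩
  ∣ y - x ∣                                 ≡⟨ ∣-∣-comm y x ⟩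
  ∣ x - y ∣                                 ∎
  where
  open ≡-Reasoning
  x+y+[K∸x] : (x + y) + (K ∸ x) ≡ K + y
  x+y+[K∸x] = trans (cong (_+ (K ∸ x)) (+-comm x y))
    (trans (+-assoc y x (K ∸ x)) (trans (cong (y +_) (m+[n∸m]≡n x≤K)) (+-comm y K)))
  x+y+[K∸y] : (x + y) + (K ∸ y) ≡ K + x
  x+y+[K∸y] = trans (+-assoc x y (K ∸ y)) (trans (cong (x +_) (m+[n∸m]≡n y≤K)) (+-comm x K))

module CircleDesign (L : ℕ) (π : Permutation′ (suc (suc L) + suc (suc L))) where
  open CirclePositions L

  m : ℕ
  m = K + k

  Team : Set
  Team = Fin (k + k)

  -- the index, in the initial placement, of the cell at position p
  cellIndex : ℕ → ℕ
  cellIndex p with p <? K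
  ... | yes _ = suc p
  ... | no  _ = k + (M ∸ p)

  cellIndex-< : ∀ {p} → p < K → cellIndex p ≡ suc p
  cellIndex-< {p} p<K with p <? K
  ... | yes _   = refl
  ... | no  p≮K = ⊥-elim (p≮K p<K)

  cellIndex-≥ : ∀ {p} → K ≤ p → cellIndex p ≡ k + (M ∸ p)
  cellIndex-≥ {p} K≤p with p <? K
  ... | yes p<K = ⊥-elim (<⇒≱ p<K K≤p)
  ... | no  _   = refl

  -- cell indices avoid 0, the fixed team's index, and stay below k + k …
  cellIndex-positive : ∀ p → ∃[ x ] cellIndex p ≡ suc x
  cellIndex-positive p with p <? K
  ... | yes _ = p , refl
  ... | no  _ = K + (M ∸ p) , refl

  cellIndex-≤ : ∀ {p} → p ≤ M → cellIndex p ≤ K + k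
  cellIndex-≤ {p} p≤M with p <? K
  ... | yes p<K = ≤-trans p<K (m≤m+n K k)
  ... | no  p≮K = ≤-trans (+-monoʳ-≤ k (M∸-≤ (≮⇒≥ p≮K))) (≤-reflexive (+-comm k K))

  cellIndex-injective : ∀ {p q} → p ≤ M → q ≤ M → cellIndex p ≡ cellIndex q → p ≡ q
  cellIndex-injective {p} {q} p≤M q≤M eq with p <? K | q <? K
  ... | yes _   | yes _   = suc-injective eq
  ... | no _    | no _    = trans (sym (m∸[m∸n]≡n p≤M))
                             (trans (cong (M ∸_) (+-cancelˡ-≡ k _ _ eq)) (m∸[m∸n]≡n q≤M))
  ... | yes p<K | no _    = ⊥-elim (<⇒≱ p<K (≤-trans (m≤m+n K _) (≤-reflexive (sym (suc-injective eq)))))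
  ... | no _    | yes q<K = ⊥-elim (<⇒≱ q<K (≤-trans (m≤m+n K _) (≤-reflexive (suc-injective eq))))

  cellIndex-onto : ∀ t → t < K + k → ∃[ c ] (c ≤ M × cellIndex c ≡ suc t)
  cellIndex-onto t t<K+k with t <? K
  ... | yes t<K = t , ≤-trans (<⇒≤ t<K) (m≤m+n K K) , cellIndex-< t<K
  ... | no  t≮K = M ∸ d , m∸n≤m M d , (begin
      cellIndex (M ∸ d)  ≡⟨ cellIndex-≥ (K≤M∸ d≤K) ⟩
      k + (M ∸ (M ∸ d))  ≡⟨ cong (k +_) (m∸[m∸n]≡n (≤-trans d≤K (m≤m+n K K))) ⟩
      suc (K + (t ∸ K))  ≡⟨ cong suc (m+[n∸m]≡n (≮⇒≥ t≮K)) ⟩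
      suc t              ∎)
    where
    open ≡-Reasoning
    d : ℕ
    d = t ∸ K
    d≤K : d ≤ K
    d≤K = m≤n+o⇒m∸n≤o t K (s≤s⁻¹ (≤-trans t<K+k (≤-reflexive (+-suc K K))))

  fixed : Team
  fixed = π ⟨$⟩ʳ zero

  initialTeam : ℕ → Team
  initialTeam p = π ⟨$⟩ʳ toFin (K + k) (cellIndex p)

  π-injective : ∀ {x y} → π ⟨$⟩ʳ x ≡ π ⟨$⟩ʳ y → x ≡ y
  π-injective eq = trans (sym (inverseˡ π)) (trans (cong (π ⟨$⟩ˡ_) eq) (inverseˡ π))

  toℕ-cell : ∀ {p} → p ≤ M → toℕ (toFin (K + k) (cellIndex p)) ≡ cellIndex p
  toℕ-cell p≤M = toℕ-toFin (K + k) _ (cellIndex-≤ p≤M)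

  initialTeam-at : ∀ {p} (i : Team) → p ≤ M → toℕ i ≡ cellIndex p → π ⟨$⟩ʳ i ≡ initialTeam p
  initialTeam-at i p≤M eq = cong (π ⟨$⟩ʳ_) (toℕ-injective (trans eq (sym (toℕ-cell p≤M))))

  initialTeam-injective : ∀ {p q} → p ≤ M → q ≤ M → initialTeam p ≡ initialTeam q → p ≡ q
  initialTeam-injective p≤M q≤M eq = cellIndex-injective p≤M q≤M
    (trans (sym (toℕ-cell p≤M)) (trans (cong toℕ (π-injective eq)) (toℕ-cell q≤M)))

  fixed≢initialTeam : ∀ p → fixed ≢ initialTeam p
  fixed≢initialTeam p eq with cellIndex-positive p
  ... | x , cell≡ = zero≢suc (trans (π-injective eq) (cong (toFin (K + k)) cell≡))

  every-team : ∀ a → a ≡ fixed ⊎ ∃[ c ] (c ≤ M × a ≡ initialTeam c)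
  every-team a with toℕ (π ⟨$⟩ˡ a) in eq
  ... | zero  = inj₁ (trans (sym (inverseʳ π)) (cong (π ⟨$⟩ʳ_) (toℕ-injective eq)))
  ... | suc t with cellIndex-onto t (s≤s⁻¹ (subst (_< k + k) eq (toℕ<n (π ⟨$⟩ˡ a))))
  ...   | c , c≤M , cell≡ =
          inj₂ (c , c≤M , trans (sym (inverseʳ π)) (initialTeam-at _ c≤M (trans eq (sym cell≡))))

  record Shows (R : Rows Team k) (f : ℕ → Team) : Set where
    field
      top-fixed : top R zero ≡ fixed
      top-at    : ∀ (j : Fin K) → top R (suc j) ≡ f (toℕ j)
      bot-at    : ∀ (j : Fin k) → bot R j ≡ f (M ∸ toℕ j)

  initial-shows : Shows (initialRows k π) initialTeam
  initial-shows = record { top-fixed = refl ; top-at = top-at ; bot-at = bot-at }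
    where
    top-at : ∀ (j : Fin K) → π ⟨$⟩ʳ (suc j ↑ˡ k) ≡ initialTeam (toℕ j)
    top-at j = initialTeam-at _ (≤-trans (<⇒≤ (toℕ<n j)) (m≤m+n K K))
      (trans (toℕ-↑ˡ (suc j) k) (sym (cellIndex-< (toℕ<n j))))
    bot-at : ∀ (j : Fin k) → π ⟨$⟩ʳ (k ↑ʳ j) ≡ initialTeam (M ∸ toℕ j)
    bot-at j = initialTeam-at _ (m∸n≤m M (toℕ j)) (trans (toℕ-↑ʳ k j) (sym (begin
      cellIndex (M ∸ toℕ j)     ≡⟨ cellIndex-≥ (K≤M∸ j≤K) ⟩
      k + (M ∸ (M ∸ toℕ j))     ≡⟨ cong (k +_) (m∸[m∸n]≡n (≤-trans j≤K (m≤m+n K K))) ⟩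
      k + toℕ j                 ∎)))
      where
      open ≡-Reasoning
      j≤K : toℕ j ≤ K
      j≤K = s≤s⁻¹ (toℕ<n j)

  rotate-shows : ∀ {R f} → Shows R f → Shows (rotate R) (f ∘ prev)
  rotate-shows {rows t b} {f} sh = record { top-fixed = top-fixed ; top-at = top-at′ ; bot-at = bot-at′ }
    where
    open Shows sh
    top-at′ : ∀ (j : Fin K) → rotTop t b (suc j) ≡ f (prev (toℕ j))
    top-at′ zero    = bot-at zero
    top-at′ (suc j) = trans (top-at (inject₁ j)) (cong f (toℕ-inject₁ j))
    bot-at′ : ∀ (j : Fin k) → rotBot b (t (fromℕ K)) j ≡ f (prev (M ∸ toℕ j))
    bot-at′ = rotBot-spec b (t (fromℕ K)) (f ∘ prev ∘ (M ∸_))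
      (λ i → trans (bot-at (suc i)) (cong (f ∘ prev) (sym (+-∸-assoc 1 (≤-trans (toℕ<n i) (m≤m+n K K))))))
      (trans (top-at (fromℕ L)) (trans (cong f (toℕ-fromℕ L)) (cong (f ∘ prev) (sym M∸K))))

  rowsAt : ℕ → Rows Team k
  rowsAt zero    = initialRows k π
  rowsAt (suc r) = rotate (rowsAt r)

  teamAt : ℕ → ℕ → Team
  teamAt r p = initialTeam (retreat p r)

  rowsAt-shows : ∀ r → Shows (rowsAt r) (teamAt r)
  rowsAt-shows zero    = initial-shows
  rowsAt-shows (suc r) = rotate-shows (rowsAt-shows r)

  open RoundIndex K hiding (k)

  gameAt : ℕ → ℕ → Game (k + k)
  gameAt r zero    = fixed , teamAt r M
  gameAt r (suc j) = teamAt r j , teamAt r (M ∸ suc j)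

  G : ℕ → Game (k + k)
  G i = gameAt (roundOf i) (slotOf i)

  G-gameAt : ∀ r s → s < k → G (r * k + s) ≡ gameAt r s
  G-gameAt r s s<k = cong₂ gameAt (proj₁ (decompose-index r s s<k)) (proj₂ (decompose-index r s s<k))

  ∈G : ∀ {a} r {s} → s < k → a ∈g gameAt r s → a ∈g G (r * k + s)
  ∈G {a} r {s} s<k = subst (a ∈g_) (sym (G-gameAt r s s<k))

  ∈gameAt : ∀ {a} r {s} → s < k → a ∈g G (r * k + s) → a ∈g gameAt r s
  ∈gameAt {a} r {s} s<k = subst (a ∈g_) (G-gameAt r s s<k)

  open Segments G
  open Rhythms L m G hiding (K)

  round-segment : ∀ r → round (rowsAt r) ≡ segment (r * k) k
  round-segment r = tabulate-segment _ (r * k) (λ j → trans (cell j) (sym (G-gameAt r (toℕ j) (toℕ<n j))))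
    where
    open Shows (rowsAt-shows r)
    cell : ∀ (j : Fin k) → (top (rowsAt r) j , bot (rowsAt r) j) ≡ gameAt r (toℕ j)
    cell zero    = cong₂ _,_ top-fixed (bot-at zero)
    cell (suc j) = cong₂ _,_ (top-at j) (bot-at (suc j))

  rounds-segment : ∀ l r → concat (map round (iterate rotate (rowsAt r) l)) ≡ segment (r * k) (l * k)
  rounds-segment zero    r = refl
  rounds-segment (suc l) r = begin
    round (rowsAt r) ++ concat (map round (iterate rotate (rowsAt (suc r)) l))
      ≡⟨ cong₂ _++_ (round-segment r) (rounds-segment l (suc r)) ⟩
    segment (r * k) k ++ segment (k + r * k) (l * k)
      ≡⟨ cong (λ x → segment (r * k) k ++ segment x (l * k)) (+-comm k (r * k)) ⟩
    segment (r * k) k ++ segment (r * k + k) (l * k)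
      ≡⟨ sym (segment-++ (r * k) k (l * k)) ⟩
    segment (r * k) (k + l * k)
      ∎
    where open ≡-Reasoning

  schedule-segment : circleSchedule k π ≡ segment 0 N
  schedule-segment = rounds-segment m 0

  1<m : 1 < m
  1<m = s≤s (≤-trans (s≤s z≤n) (m≤n+m k L))

  index<N : ∀ {r s} → r < m → s < k → r * k + s < N
  index<N {r} {s} r<m s<k = subst (r * k + s <_) (+-identityʳ N) (index-< _ 0 s<k r<m)

  gameNo : ∀ t → t < N → Fin (length (segment 0 N))
  gameNo t t<N = fromℕ< (subst (t <_) (sym (length-segment 0 N)) t<N)

  toℕ-gameNo : ∀ t (t<N : t < N) → toℕ (gameNo t t<N) ≡ t
  toℕ-gameNo t t<N = toℕ-fromℕ< _

  lookup-gameNo : ∀ t (t<N : t < N) → lookup (segment 0 N) (gameNo t t<N) ≡ G t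
  lookup-gameNo t t<N = trans (lookup-segment 0 N (gameNo t t<N)) (cong G (toℕ-gameNo t t<N))

  fixedRhythm : Rhythm fixed (λ _ → 0)
  fixedRhythm = record { slot≤K = λ _ → z≤n ; plays = λ r _ → ∈G r (s≤s z≤n) (inj₁ refl) ; onlyThere = only }
    where
    only : ∀ r s → r < m → s < k → fixed ∈g G (r * k + s) → s ≡ 0
    only r zero    _ _   _ = refl
    only r (suc j) _ s<k p with ∈gameAt r s<k p
    ... | inj₁ eq = ⊥-elim (fixed≢initialTeam (retreat j r) eq)
    ... | inj₂ eq = ⊥-elim (fixed≢initialTeam (retreat (M ∸ suc j) r) eq)

  teamAt-plays : ∀ r {p} → p ≤ M → teamAt r p ∈g gameAt r (slot p)
  teamAt-plays r {p} p≤M with p <? K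
  ... | yes _ = inj₁ refl
  ... | no  _ with m≤n⇒m<n∨m≡n p≤M
  ...   | inj₂ refl = subst (λ s → teamAt r M ∈g gameAt r s) (sym (n∸n≡0 M)) (inj₂ refl)
  ...   | inj₁ p<M  = subst (λ s → teamAt r p ∈g gameAt r s) (sym (+-∸-assoc 1 p<M))
                        (inj₂ (cong (teamAt r) (sym M∸[M∸1+p]≡p)))
    where
    M∸[M∸1+p]≡p : M ∸ suc (M ∸ suc p) ≡ p
    M∸[M∸1+p]≡p = trans (cong (M ∸_) (sym (+-∸-assoc 1 p<M))) (m∸[m∸n]≡n p≤M)

  located : ∀ {c} r {p} → c ≤ M → p ≤ M → initialTeam c ≡ teamAt r p → advance c r ≡ p
  located {c} r {p} c≤M p≤M eq =
    trans (cong (λ x → advance x r) (initialTeam-injective c≤M (retreat-≤ r p≤M) eq)) (advance-retreat p r p≤M)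

  rotatingRhythm : ∀ {c} → c ≤ M → Rhythm (initialTeam c) (λ r → slot (advance c r))
  rotatingRhythm {c} c≤M = record { slot≤K = λ r → slot≤K (advance c r) ; plays = plays ; onlyThere = only }
    where
    plays : ∀ r → r < m → initialTeam c ∈g G (r * k + slot (advance c r))
    plays r _ = ∈G r (s≤s (slot≤K (advance c r))) (subst (λ x → initialTeam x ∈g gameAt r (slot (advance c r)))
                  (retreat-advance c r c≤M) (teamAt-plays r (advance-≤ r c≤M)))
    slot-there : ∀ r s → s < k → initialTeam c ∈g gameAt r s → slot (advance c r) ≡ s
    slot-there r zero    _   (inj₁ eq) = ⊥-elim (fixed≢initialTeam c (sym eq))
    slot-there r zero    _   (inj₂ eq) = trans (cong slot (located r c≤M ≤-refl eq)) slot-M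
    slot-there r (suc j) s<k (inj₁ eq) =
      trans (cong slot (located r c≤M (≤-trans (<⇒≤ (s≤s⁻¹ s<k)) (m≤m+n K K)) eq)) (slot-< (s≤s⁻¹ s<k))
    slot-there r (suc j) s<k (inj₂ eq) =
      trans (cong slot (located r c≤M (m∸n≤m M (suc j)) eq)) (slot-bottom (s≤s⁻¹ s<k))
    only : ∀ r s → r < m → s < k → initialTeam c ∈g G (r * k + s) → s ≡ slot (advance c r)
    only r s _ s<k p = sym (slot-there r s s<k (∈gameAt r s<k p))

  rotatingDescent : ∀ {c} → c ≤ M → SlowDescent (λ r → slot (advance c r))
  rotatingDescent c≤M r = slot-descent (advance-≤ r c≤M)

  rhythm : ∀ a → ∃[ σ ] (Rhythm a σ × SlowDescent σ)
  rhythm a with every-team a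
  ... | inj₁ refl              = (λ _ → 0) , fixedRhythm , (λ _ → z≤n)
  ... | inj₂ (c , c≤M , refl) = _ , rotatingRhythm c≤M , rotatingDescent c≤M

  restDifference : ℕ → ℕ → ℕ
  restDifference zero    s = 0
  restDifference (suc r) s = ∣ earlierSlotTop s - earlierSlotBottom s ∣

  idle-rotating : ∀ r p s → p ≤ M → suc r < m → s < k → teamAt (suc r) p ∈g gameAt (suc r) s →
                  idle (teamAt (suc r) p) (segment 0 (suc r * k + s)) ≡ (K ∸ slot (prev p)) + s
  idle-rotating r p s p≤M r+1<m s<k mem =
    trans (idle-next-round (rotatingRhythm (retreat-≤ (suc r) p≤M)) r s r+1<m s<k (∈G (suc r) s<k mem))
          (cong (λ q → (K ∸ slot q) + s) (advance-retreat (prev p) r (prev-≤ p≤M)))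

  -- in round 0 both teams have been idle for s games; later the idle times are
  -- (K − previous slot) + s, whose difference is that of the previous slots
  restDifference-value : ∀ r s → r < m → s < k →
    ∣ idle (proj₁ (gameAt r s)) (segment 0 (r * k + s)) - idle (proj₂ (gameAt r s)) (segment 0 (r * k + s)) ∣
      ≡ restDifference r s
  restDifference-value zero s 0<m s<k = trans
    (cong₂ ∣_-_∣ (idle-round0 (proj₁ (proj₂ (rhythm u))) 0<m s s<k (∈G 0 s<k (inj₁ refl)))
                 (idle-round0 (proj₁ (proj₂ (rhythm v))) 0<m s s<k (∈G 0 s<k (inj₂ refl))))
    (∣n-n∣≡0 s)
    where
    u : Team
    u = proj₁ (gameAt 0 s)
    v : Team
    v = proj₂ (gameAt 0 s)
  restDifference-value (suc r) zero r+1<m s<k = trans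
    (cong₂ ∣_-_∣ (idle-next-round fixedRhythm r 0 r+1<m s<k (∈G (suc r) s<k (inj₁ refl)))
                 (idle-rotating r M 0 ≤-refl r+1<m s<k (inj₂ refl)))
    (∣K∸+-K∸+∣ 0 z≤n (slot≤K (prev M)))
  restDifference-value (suc r) (suc j) r+1<m s<k = trans
    (cong₂ ∣_-_∣ (idle-rotating r j (suc j) (≤-trans (<⇒≤ (s≤s⁻¹ s<k)) (m≤m+n K K)) r+1<m s<k (inj₁ refl))
                 (idle-rotating r (M ∸ suc j) (suc j) (m∸n≤m M (suc j)) r+1<m s<k (inj₂ refl)))
    (∣K∸+-K∸+∣ (suc j) (slot≤K (prev j)) (slot≤K (prev (M ∸ suc j))))

  restDifference-cases : ∀ r s → s < k → restDifference r s ≤ 1 ⊎ (restDifference r s ≡ 2 × 1 ≤ L)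
  restDifference-cases zero    s       _   = inj₁ z≤n
  restDifference-cases (suc r) zero    _   = inj₁ (≤-reflexive (cong (λ x → ∣ 0 - x ∣) earlierSlotBottom-0))
  restDifference-cases (suc r) (suc j) s<k with j <? L
  ... | yes j<L = inj₂ (trans (cong₂ ∣_-_∣ (earlierSlotTop-suc (s≤s⁻¹ s<k)) (earlierSlotBottom-< j<L))
                              (trans (cong (∣ j -_∣) (+-comm 2 j)) (∣m-m+n∣≡n j 2))
                       , ≤-trans (s≤s z≤n) j<L)
  ... | no  j≮L = inj₁ (≤-reflexive (trans (cong₂ ∣_-_∣ (earlierSlotTop-suc (s≤s⁻¹ s<k)) (cong earlierSlotBottom (cong suc j≡L)))
                    (trans (cong₂ ∣_-_∣ j≡L earlierSlotBottom-L) (trans (cong (∣ L -_∣) (+-comm 1 L)) (∣m-m+n∣≡n L 1)))))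
    where
    j≡L : j ≡ L
    j≡L = ≤-antisym (s≤s⁻¹ (s≤s⁻¹ s<k)) (≮⇒≥ j≮L)

  restDifference≤2 : ∀ r s → s < k → restDifference r s ≤ 2
  restDifference≤2 r s s<k with restDifference-cases r s s<k
  ... | inj₁ ≤1      = m≤n⇒m≤1+n ≤1
  ... | inj₂ (≡2 , _) = ≤-reflexive ≡2

  restDifference≤1 : L ≡ 0 → ∀ r s → s < k → restDifference r s ≤ 1
  restDifference≤1 L≡0 r s s<k with restDifference-cases r s s<k
  ... | inj₁ ≤1        = ≤1
  ... | inj₂ (_ , 1≤L) = ⊥-elim (<⇒≱ 1≤L (≤-reflexive L≡0))

  restDifference-at : ∀ (j : Fin (length (segment 0 N))) →
    ∣ idle (proj₁ (lookup (segment 0 N) j)) (take (toℕ j) (segment 0 N))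
    - idle (proj₂ (lookup (segment 0 N) j)) (take (toℕ j) (segment 0 N)) ∣
      ≡ restDifference (roundOf (toℕ j)) (slotOf (toℕ j))
  restDifference-at j = trans
    (cong₂ (λ g gs → ∣ idle (proj₁ g) gs - idle (proj₂ g) gs ∣) (lookup-segment 0 N j) (take-segment 0 N t (<⇒≤ t<N)))
    (trans (cong (λ i → ∣ idle (proj₁ (G t)) (segment 0 i) - idle (proj₂ (G t)) (segment 0 i) ∣) (index-decompose t))
           (restDifference-value (roundOf t) (slotOf t) (roundOf-< t<N) (slotOf<k t)))
    where
    t : ℕ
    t = toℕ j
    t<N : t < N
    t<N = subst (t <_) (length-segment 0 N) (toℕ<n j)

  restDiffAtMost : ∀ d → (∀ r s → s < k → restDifference r s ≤ d) → RestDiffAtMost (segment 0 N) d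
  restDiffAtMost d bound j = ≤-trans (≤-reflexive (restDifference-at j)) (bound (roundOf (toℕ j)) (slotOf (toℕ j)) (slotOf<k (toℕ j)))

  restDiff-attained : ∀ s → s < k → ∀ e → RestDiffAtMost (segment 0 N) e → restDifference 1 s ≤ e
  restDiff-attained s s<k e diff = subst (_≤ e) (trans (restDifference-at j) (cong₂ restDifference r≡1 s≡s)) (diff j)
    where
    t<N = index<N 1<m s<k
    j : Fin (length (segment 0 N))
    j = gameNo (1 * k + s) t<N
    r≡1 : roundOf (toℕ j) ≡ 1
    r≡1 = trans (cong roundOf (toℕ-gameNo _ t<N)) (proj₁ (decompose-index 1 s s<k))
    s≡s : slotOf (toℕ j) ≡ s
    s≡s = trans (cong slotOf (toℕ-gameNo _ t<N)) (proj₂ (decompose-index 1 s s<k))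

  -- the team starting at position K plays slot K of round 0 and slot L of
  -- round 1, with only L games in between
  restAtMost : ∀ c → RestAtLeast (segment 0 N) c → c ≤ L
  restAtMost c rest = subst (c ≤_) gap≡L (restAtLeast-≤-gap a i j i<j (at t₁ t₁<N first) (at t₂ t₂<N second) rest)
    where
    a : Team
    a = initialTeam K
    ρ : Rhythm a (λ r → slot (advance K r))
    ρ = rotatingRhythm (m≤m+n K K)
    t₁ : ℕ
    t₁ = K
    t₂ : ℕ
    t₂ = 1 * k + L
    first : a ∈g G t₁
    first = subst (λ s → a ∈g G s) (trans (slot-≥ ≤-refl) M∸K) (Rhythm.plays ρ 0 (<-trans (s≤s z≤n) 1<m))
    second : a ∈g G t₂
    second = subst (λ s → a ∈g G (1 * k + s))
      (trans (cong slot (next-< (m<m+n K (s≤s z≤n)))) (trans (slot-≥ (n≤1+n K)) (m+n∸n≡m L K)))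
      (Rhythm.plays ρ 1 1<m)
    t₁<N : t₁ < N
    t₁<N = index<N (<-trans (s≤s z≤n) 1<m) (n<1+n K)
    t₂<N : t₂ < N
    t₂<N = index<N 1<m (n≤1+n K)
    i : Fin (length (segment 0 N))
    i = gameNo t₁ t₁<N
    j : Fin (length (segment 0 N))
    j = gameNo t₂ t₂<N
    at : ∀ t (t<N : t < N) → a ∈g G t → a ∈g lookup (segment 0 N) (gameNo t t<N)
    at t t<N = subst (a ∈g_) (sym (lookup-gameNo t t<N))
    i<j : toℕ i < toℕ j
    i<j = subst₂ _<_ (sym (toℕ-gameNo t₁ t₁<N)) (sym (toℕ-gameNo t₂ t₂<N))
                 (≤-trans (≤-reflexive (sym (*-identityˡ k))) (m≤m+n (1 * k) L))
    gap≡L : toℕ j ∸ suc (toℕ i) ≡ L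
    gap≡L = trans (cong₂ (λ x y → x ∸ suc y) (toℕ-gameNo t₂ t₂<N) (toℕ-gameNo t₁ t₁<N))
                  (trans (cong (λ x → x + L ∸ k) (*-identityˡ k)) (m+n∸m≡n k L))

  -- after the first game the fixed team is one game ahead of the team at position 0
  playedDiff-attained : ∀ q → PlayedDiffAtMost (segment 0 N) q → 1 ≤ q
  playedDiff-attained q = playedDiff-≥1 (∈G 0 (s≤s z≤n) (inj₁ refl)) notFirst
    where
    notFirst : ¬ initialTeam 0 ∈g G 0
    notFirst p with ∈gameAt 0 (s≤s z≤n) p
    ... | inj₁ eq = fixed≢initialTeam 0 (sym eq)
    ... | inj₂ eq with initialTeam-injective z≤n ≤-refl eq
    ...   | ()

  guaranteedRestTime : GuaranteedRestTime (segment 0 N) L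
  guaranteedRestTime = restAtLeast rhythm , restAtMost

  gamesPlayedDifference : GamesPlayedDifferenceIndex (segment 0 N) 1
  gamesPlayedDifference = playedDiff≤1 (λ a → proj₁ (rhythm a) , proj₁ (proj₂ (rhythm a))) , playedDiff-attained

  restDifferenceIndex-2 : 1 ≤ L → RestDifferenceIndex (segment 0 N) 2
  restDifferenceIndex-2 1≤L = restDiffAtMost 2 restDifference≤2 , λ e diff →
    subst (_≤ e) (cong₂ ∣_-_∣ (earlierSlotTop-suc (s≤s z≤n)) (earlierSlotBottom-< 1≤L))
          (restDiff-attained 1 (s≤s (s≤s z≤n)) e diff)

  restDifferenceIndex-1 : L ≡ 0 → RestDifferenceIndex (segment 0 N) 1
  restDifferenceIndex-1 L≡0 = restDiffAtMost 1 (restDifference≤1 L≡0) , λ e diff →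
    subst (_≤ e) (cong (λ x → ∣ 0 - x ∣) earlierSlotBottom-0) (restDiff-attained 0 (s≤s z≤n) e diff)

proposition3p2 : ∀ (k : ℕ) → 2 ≤ k → (π : Permutation′ (k + k)) →
    GuaranteedRestTime (circleSchedule k π) (k ∸ 2)
    × GamesPlayedDifferenceIndex (circleSchedule k π) 1
    × (3 ≤ k → RestDifferenceIndex (circleSchedule k π) 2)
    × (k ≡ 2 → RestDifferenceIndex (circleSchedule k π) 1)
proposition3p2 (suc (suc L)) (s≤s (s≤s z≤n)) π =
  subst Properties (sym schedule-segment)
    ( guaranteedRestTime
    , gamesPlayedDifference
    , (λ 3≤k → restDifferenceIndex-2 (s≤s⁻¹ (s≤s⁻¹ 3≤k)))
    , (λ k≡2 → restDifferenceIndex-1 (suc-injective (suc-injective k≡2))) )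
  where
  open CircleDesign L π
  Properties : Schedule (suc (suc L) + suc (suc L)) → Set
  Properties S = GuaranteedRestTime S L × GamesPlayedDifferenceIndex S 1
               × (3 ≤ suc (suc L) → RestDifferenceIndex S 2) × (suc (suc L) ≡ 2 → RestDifferenceIndex S 1)
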